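{- The name-generation monad $T$ on $[\mathsf{Inj},\mathsf{Set}]$ is observational.
   Context: $\mathsf{Inj}$ is the category of finite sets and injective maps; $a+b$ denotes disjoint union. $[\mathsf{Inj},\mathsf{Set}]$ is the category of functors $\mathsf{Inj}\to\mathsf{Set}$ (cartesian monoidal, products pointwise). The name-generation monad is $(TX)a=\mathrm{colim}_{b\in\mathsf{Inj}}X(a+b)$: an element is an equivalence class $[b,x]$ with $b$ a finite set (of locally generated names) and $x\in X(a+b)$, where $[b,x]=[b',X(1_a+f)(x)]$ for injections $f:b\to b'$. Unit $\eta(x)=[\emptyset,x]$, multiplication $[b,[c,x]]\mapsto[b+c,x]$; $T$ is commutative and affine ($T1\cong1$), with $\nabla([b,x],[b',y])=[b+b',(x,y)]$ (suitably reindexed). For a commutative monad $T$: Kleisli morphisms $f:A\rightsquigarrow B$ are maps $f^\sharp:A\to TB$, composition $(g\circledcirc f)^\sharp=\mu\circ Tg^\sharp\circ f^\sharp$; $\mathsf{Kl}(T)$ is monoidal with $A\otimes B=A\times B$, $(f\otimes g)^\sharp=\nabla\circ(f^\sharp\times g^\sharp)$; $(\mathsf{copy}_X)^\sharp=\eta\circ\Delta_X$, $(\mathsf{del}_X)^\sharp=\eta_1\circ!_X$; $\mathsf{copy}_n$ is the iterated copy ($\mathsf{copy}_0=\mathsf{del}$); $(\mathsf{force}_X)^\sharp=1_{TX}$; $\mathsf{samp}_n=\mathsf{force}^{\otimes n}\circledcirc\mathsf{copy}_n:TX\rightsquigarrow X^{\otimes n}$. $T$ is observational if for every $X$ the family $(\mathsf{samp}_n)_{n\in\mathbb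 N}$ is jointly monic in $\mathsf{Kl}(T)$. -}

module Defs where

open import Level using (0ℓ)
open import Data.Nat using (ℕ; zero; suc; _+_)
open import Data.Nat.Properties using (+-assoc)
open import Data.Fin using (Fin; _↑ˡ_; _↑ʳ_; splitAt; join; cast)
open import Data.Fin.Properties using (↑ˡ-injective; ↑ʳ-injective; splitAt-join; join-splitAt; cast-involutive)
open import Data.Sum using (_⊎_; inj₁; inj₂)
import Data.Sum as Sum
open import Data.Sum.Properties using (inj₁-injective; inj₂-injective)
open import Data.Product using (Σ; _,_; _×_; proj₁; proj₂)
open import Data.Product.Relation.Binary.Pointwise.NonDependent using (×-setoid)
open import Data.Unit using (⊤; tt)
open import Function using (_∘_)
open import Function.Definitions using (Injective)
open import Relation.Binary.Bundles using (Setoid)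
open import Relation.Binary.Structures using (IsEquivalence)
open import Relation.Binary.PropositionalEquality
  using (_≡_; refl; cong; sym; trans)
import Relation.Binary.PropositionalEquality as P

-- The category Inj (skeleton: objects n ∈ ℕ standing for Fin n,
-- morphisms injective functions).

record Inj (a b : ℕ) : Set where
  constructor mkInj
  field
    fun       : Fin a → Fin b
    injective : Injective _≡_ _≡_ fun
open Inj public

idI : ∀ {a} → Inj a a
idI = mkInj (λ i → i) (λ e → e)

_∘I_ : ∀ {a b c} → Inj b c → Inj a b → Inj a c
g ∘I f = mkInj (fun g ∘ fun f) (injective f ∘ injective g)

_≗I_ : ∀ {a b} → Inj a b → Inj a b → Set
f ≗I g = ∀ i → fun f i ≡ fun g i

private
  map-inj : ∀ {A B C D : Set} {f : A → B} {g : C → D} →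
            Injective _≡_ _≡_ f → Injective _≡_ _≡_ g →
            Injective _≡_ _≡_ (Sum.map f g)
  map-inj fi gi {inj₁ x} {inj₁ y} e = cong inj₁ (fi (inj₁-injective e))
  map-inj fi gi {inj₁ x} {inj₂ y} ()
  map-inj fi gi {inj₂ x} {inj₁ y} ()
  map-inj fi gi {inj₂ x} {inj₂ y} e = cong inj₂ (gi (inj₂-injective e))

_⊕_ : ∀ {a a' b b'} → Inj a a' → Inj b b' → Inj (a + b) (a' + b')
_⊕_ {a} {a'} {b} {b'} f g =
  mkInj (join a' b' ∘ Sum.map (fun f) (fun g) ∘ splitAt a) inj
  where
  inj : ∀ {i j} → join a' b' (Sum.map (fun f) (fun g) (splitAt a i))
                ≡ join a' b' (Sum.map (fun f) (fun g) (splitAt a j)) → i ≡ j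
  inj {i} {j} e =
    let e1 = trans (sym (splitAt-join a' b' (Sum.map (fun f) (fun g) (splitAt a i))))
                   (trans (cong (splitAt a') e)
                          (splitAt-join a' b' (Sum.map (fun f) (fun g) (splitAt a j))))
        e2 = map-inj (injective f) (injective g) {splitAt a i} {splitAt a j} e1
    in trans (sym (join-splitAt a b i))
             (trans (cong (join a b) e2) (join-splitAt a b j))

inlI : ∀ {b} b' → Inj b (b + b')
inlI b' = mkInj (_↑ˡ b') (λ {i} {j} → ↑ˡ-injective b' i j)

inrI : ∀ b {b'} → Inj b' (b + b')
inrI b = mkInj (b ↑ʳ_) (λ {i} {j} → ↑ʳ-injective b i j)

runitI : ∀ a → Inj a (a + 0)
runitI a = inlI 0

assocI : ∀ a b c → Inj ((a + b) + c) (a + (b + c))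
assocI a b c = mkInj (cast (+-assoc a b c))
  (λ {i} {j} e → trans (sym (cast-involutive (sym (+-assoc a b c)) (+-assoc a b c) i))
                  (trans (cong (cast (sym (+-assoc a b c))) e)
                         (cast-involutive (sym (+-assoc a b c)) (+-assoc a b c) j)))

-- Objects of [Inj, Set].  Since Agda has no quotient types, sets are
-- represented by setoids; PreObj is the raw data of such a functor,
-- Obj adds the functor laws.

record PreObj : Set₁ where
  field
    S   : ℕ → Setoid 0ℓ 0ℓ
    act : ∀ {a b} → Inj a b → Setoid.Carrier (S a) → Setoid.Carrier (S b)

∣_∣ : PreObj → ℕ → Set
∣ A ∣ a = Setoid.Carrier (PreObj.S A a)

Eq : (A : PreObj) (a : ℕ) → ∣ A ∣ a → ∣ A ∣ a → Set
Eq A a = Setoid._≈_ (PreObj.S A a)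

record Obj : Set₁ where
  field
    pre     : PreObj
  open PreObj pre
  field
    act-cong : ∀ {a b} (f g : Inj a b) → f ≗I g → ∀ {x y} →
               Eq pre a x y → Eq pre b (act f x) (act g y)
    act-id   : ∀ {a} (x : ∣ pre ∣ a) → Eq pre a (act idI x) x
    act-∘    : ∀ {a b c} (g : Inj b c) (f : Inj a b) (x : ∣ pre ∣ a) →
               Eq pre c (act (g ∘I f) x) (act g (act f x))

-- The name-generation monad:  (T X) a = colim_b X (a + b).

module _ (X : PreObj) where
  open PreObj X

  TCar : ℕ → Set
  TCar a = Σ ℕ (λ b → ∣ X ∣ (a + b))

  data TRel {a : ℕ} : TCar a → TCar a → Set where
    t-lift  : ∀ {b x y} → Eq X (a + b) x y → TRel (b , x) (b , y)
    t-step  : ∀ {b b'} (f : Inj b b') (x : ∣ X ∣ (a + b)) →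
              TRel (b , x) (b' , act (idI ⊕ f) x)
    t-refl  : ∀ {u} → TRel u u
    t-sym   : ∀ {u v} → TRel u v → TRel v u
    t-trans : ∀ {u v w} → TRel u v → TRel v w → TRel u w

  TSetoid : ℕ → Setoid 0ℓ 0ℓ
  TSetoid a = record
    { Carrier = TCar a
    ; _≈_ = TRel
    ; isEquivalence = record { refl = t-refl ; sym = t-sym ; trans = t-trans } }

  Tact : ∀ {a a'} → Inj a a' → TCar a → TCar a'
  Tact f (b , x) = b , act (f ⊕ idI) x

T : PreObj → PreObj
T X = record { S = TSetoid X ; act = Tact X }

One : PreObj
One = record { S = λ _ → P.setoid ⊤ ; act = λ _ _ → tt }

_⊗_ : PreObj → PreObj → PreObj
A ⊗ B = record
  { S = λ a → ×-setoid (PreObj.S A a) (PreObj.S B a)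
  ; act = λ f p → PreObj.act A f (proj₁ p) , PreObj.act B f (proj₂ p) }

pow : PreObj → ℕ → PreObj
pow X zero    = One
pow X (suc n) = X ⊗ pow X n

Hom : PreObj → PreObj → Set
Hom A B = ∀ a → ∣ A ∣ a → ∣ B ∣ a

η : (A : PreObj) → Hom A (T A)
η A a x = 0 , PreObj.act A (runitI a) x

μ : (A : PreObj) → Hom (T (T A)) (T A)
μ A a (b , (c , x)) = b + c , PreObj.act A (assocI a b c) x

Tmap : {A B : PreObj} → Hom A B → Hom (T A) (T B)
Tmap h a (b , x) = b , h (a + b) x

∇ : (A B : PreObj) → Hom (T A ⊗ T B) (T (A ⊗ B))
∇ A B a ((b , x) , (b' , y)) =
  b + b' , ( PreObj.act A (_⊕_ {a} {a} {b} {b + b'} idI (inlI b')) x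
           , PreObj.act B (_⊕_ {a} {a} {b'} {b + b'} idI (inrI b)) y)

Sharp : PreObj → PreObj → Set
Sharp A B = Hom A (T B)

_⊚_ : {A B C : PreObj} → Sharp B C → Sharp A B → Sharp A C
_⊚_ {B = B} {C = C} g f a x = μ C a (Tmap {B} {T C} g a (f a x))

idK : (A : PreObj) → Sharp A A
idK = η

_⊗K_ : {A A' B B' : PreObj} → Sharp A B → Sharp A' B' → Sharp (A ⊗ A') (B ⊗ B')
_⊗K_ {B = B} {B' = B'} f g a (x , y) = ∇ B B' a (f a x , g a y)

copy : (X : PreObj) → Sharp X (X ⊗ X)
copy X a x = η (X ⊗ X) a (x , x)

del : (X : PreObj) → Sharp X One
del X a x = η One a tt

copyN : (X : PreObj) (n : ℕ) → Sharp X (pow X n)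
copyN X zero    = del X
copyN X (suc n) = _⊚_ {X} {X ⊗ X} {pow X (suc n)} (_⊗K_ {X} {X} {X} {pow X n} (idK X) (copyN X n)) (copy X)

force : (X : PreObj) → Sharp (T X) X
force X a t = t

forceN : (X : PreObj) (n : ℕ) → Sharp (pow (T X) n) (pow X n)
forceN X zero    = idK One
forceN X (suc n) = _⊗K_ {T X} {pow (T X) n} {X} {pow X n} (force X) (forceN X n)

samp : (X : PreObj) (n : ℕ) → Sharp (T X) (pow X n)
samp X n = _⊚_ {T X} {pow (T X) n} {pow X n} (forceN X n) (copyN (T X) n)

record KlMor (A B : PreObj) : Set where
  field
    sharp   : Sharp A B
    cong♯   : ∀ a {x y} → Eq A a x y → Eq (T B) a (sharp a x) (sharp a y)
    natural : ∀ {a a'} (f : Inj a a') (x : ∣ A ∣ a) →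
              Eq (T B) a' (sharp a' (PreObj.act A f x))
                          (PreObj.act (T B) f (sharp a x))
open KlMor public

_≈K_ : {A B : PreObj} → Sharp A B → Sharp A B → Set
_≈K_ {A} {B} f g = ∀ a (x : ∣ A ∣ a) → Eq (T B) a (f a x) (g a x)

JointlyMonic : {A : PreObj} {B : ℕ → PreObj} → ((n : ℕ) → Sharp A (B n)) → Set₁
JointlyMonic {A} {B} s =
  ∀ (Y : Obj) (f g : KlMor (Obj.pre Y) A) →
  (∀ n → _≈K_ {Obj.pre Y} {B n}
           (_⊚_ {Obj.pre Y} {A} {B n} (s n) (sharp f))
           (_⊚_ {Obj.pre Y} {A} {B n} (s n) (sharp g))) →
  _≈K_ {Obj.pre Y} {A} (sharp f) (sharp g)

Observational : Set₁
Observational = ∀ (X : Obj) →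
  JointlyMonic {T (Obj.pre X)} {pow (Obj.pre X)} (samp (Obj.pre X))

{-# OPTIONS --safe #-}
-- An element of T (T X) at a is [c , [b , x]] with x ∈ X ((a + c) + b): besides the a free
-- names, x uses c names bound by the outer and b names bound by the inner binder.  Its n-th
-- sample is [c + P , (x₁ , … , xₙ)], where xᵢ is x with its inner names moved to a block of
-- fresh names of its own, the n blocks being pairwise disjoint.  If the n-th samples of
-- [c , [b , x]] and [c' , [b' , x']] are equal, injections of their bound names into a common
-- D identify the copies.  A name coming from c or c' can meet the fresh block of at most one
-- copy, so for n > c + c' some copy i meets none of them on either side.  Declaring the names
-- of D that come from c or c' outer and all others inner turns copy i into a single element
-- [D , [D , z]] to which both [c , [b , x]] and [c' , [b' , x']] are equivalent.

module Submission where

open import Defs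
open import Data.Nat using (ℕ; zero; suc; _+_; _<_)
open import Data.Nat.Properties using (+-assoc; m+n≮m; n<1+n)
import Data.Fin as Fin
open import Data.Fin using (Fin; _↑ˡ_; _↑ʳ_; splitAt; toℕ; _≟_)
open import Data.Fin.Properties
  using (splitAt-↑ˡ; splitAt-↑ʳ; splitAt⁻¹-↑ˡ; splitAt⁻¹-↑ʳ; ↑ˡ-injective; ↑ʳ-injective;
         toℕ-↑ˡ; toℕ-↑ʳ; toℕ-cast; toℕ-injective; toℕ<n; any?; pigeonhole; <⇒≢)
open import Data.Sum using (_⊎_; inj₁; inj₂; [_,_]′)
open import Data.Product using (Σ; ∃; _,_; _×_; proj₁; proj₂)
open import Data.Empty using (⊥-elim)
open import Function using (_∘_)
open import Relation.Nullary using (¬_; Dec; yes; no)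
open import Relation.Nullary.Decidable using (¬?; _⊎-dec_; decidable-stable)
open import Relation.Unary using (Decidable)
open import Relation.Binary.Bundles using (Setoid)
import Relation.Binary.Reasoning.Setoid as SetoidReasoning
open import Relation.Binary.PropositionalEquality
  using (_≡_; _≢_; refl; sym; trans; cong; subst; module ≡-Reasoning)

-- Finite sets and injections

data SplitView (m n : ℕ) : Fin (m + n) → Set where
  ↑ˡ-view : (i : Fin m) → SplitView m n (i ↑ˡ n)
  ↑ʳ-view : (j : Fin n) → SplitView m n (m ↑ʳ j)

splitView : ∀ m n (i : Fin (m + n)) → SplitView m n i
splitView m n i with splitAt m i in eq
... | inj₁ j = subst (SplitView m n) (splitAt⁻¹-↑ˡ eq) (↑ˡ-view j)
... | inj₂ j = subst (SplitView m n) (splitAt⁻¹-↑ʳ eq) (↑ʳ-view j)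

↑ˡ≢↑ʳ : ∀ {m n} (i : Fin m) (j : Fin n) → i ↑ˡ n ≢ m ↑ʳ j
↑ˡ≢↑ʳ {m} {n} i j e = m+n≮m m (toℕ j) (subst (_< m) toℕ-eq (toℕ<n i))
  where
  toℕ-eq : toℕ i ≡ m + toℕ j
  toℕ-eq = trans (sym (toℕ-↑ˡ i n)) (trans (cong toℕ e) (toℕ-↑ʳ m j))

pigeonhole-∃¬ : ∀ {N n} → N < n → (B : Fin n → Set) → Decidable B →
                (label : ∀ i → B i → Fin N) →
                (∀ {i i'} (β : B i) (β' : B i') → label i β ≡ label i' β' → i ≡ i') →
                ∃ λ i → ¬ B i
pigeonhole-∃¬ N<n B B? label label-injective with any? (¬? ∘ B?)
... | yes found = found
... | no none with pigeonhole N<n (λ i → label i (decidable-stable (B? i) (λ ¬β → none (i , ¬β))))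
... | i , j , i<j , same = ⊥-elim (<⇒≢ i<j (label-injective _ _ same))

↑-ext : ∀ {m n l} {f g : Fin (m + n) → Fin l} →
        (∀ i → f (i ↑ˡ n) ≡ g (i ↑ˡ n)) → (∀ j → f (m ↑ʳ j) ≡ g (m ↑ʳ j)) →
        ∀ i → f i ≡ g i
↑-ext {m} {n} fl fr i with splitView m n i
... | ↑ˡ-view i' = fl i'
... | ↑ʳ-view j  = fr j

⊕-↑ˡ : ∀ {a a' b b'} (f : Inj a a') (g : Inj b b') (i : Fin a) →
       fun (f ⊕ g) (i ↑ˡ b) ≡ fun f i ↑ˡ b'
⊕-↑ˡ {a} {b = b} f g i rewrite splitAt-↑ˡ a i b = refl

⊕-↑ʳ : ∀ {a a' b b'} (f : Inj a a') (g : Inj b b') (j : Fin b) →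
       fun (f ⊕ g) (a ↑ʳ j) ≡ a' ↑ʳ fun g j
⊕-↑ʳ {a} {b = b} f g j rewrite splitAt-↑ʳ a b j = refl

⊕-cong : ∀ {a a' b b'} {f f' : Inj a a'} {g g' : Inj b b'} →
         f ≗I f' → g ≗I g' → (f ⊕ g) ≗I (f' ⊕ g')
⊕-cong {a' = a'} {b' = b'} {f} {f'} {g} {g'} f≗f' g≗g' = ↑-ext
  (λ i → trans (⊕-↑ˡ f g i) (trans (cong (_↑ˡ b') (f≗f' i)) (sym (⊕-↑ˡ f' g' i))))
  (λ j → trans (⊕-↑ʳ f g j) (trans (cong (a' ↑ʳ_) (g≗g' j)) (sym (⊕-↑ʳ f' g' j))))

⊕-∘ : ∀ {a a' a'' b b' b''} (f : Inj a' a'') (g : Inj b' b'') (f' : Inj a a') (g' : Inj b b') →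
      ((f ⊕ g) ∘I (f' ⊕ g')) ≗I ((f ∘I f') ⊕ (g ∘I g'))
⊕-∘ f g f' g' = ↑-ext
  (λ i → trans (cong (fun (f ⊕ g)) (⊕-↑ˡ f' g' i))
               (trans (⊕-↑ˡ f g (fun f' i)) (sym (⊕-↑ˡ (f ∘I f') (g ∘I g') i))))
  (λ j → trans (cong (fun (f ⊕ g)) (⊕-↑ʳ f' g' j))
               (trans (⊕-↑ʳ f g (fun g' j)) (sym (⊕-↑ʳ (f ∘I f') (g ∘I g') j))))

⊕-id : ∀ {a b} → (idI {a} ⊕ idI {b}) ≗I idI
⊕-id {a} {b} = ↑-ext (⊕-↑ˡ (idI {a}) (idI {b})) (⊕-↑ʳ (idI {a}) (idI {b}))

assocI-↑ˡ-↑ˡ : ∀ {a} b c (i : Fin a) → fun (assocI a b c) ((i ↑ˡ b) ↑ˡ c) ≡ i ↑ˡ (b + c)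
assocI-↑ˡ-↑ˡ {a} b c i = toℕ-injective (begin
  toℕ (fun (assocI a b c) ((i ↑ˡ b) ↑ˡ c)) ≡⟨ toℕ-cast _ _ ⟩
  toℕ ((i ↑ˡ b) ↑ˡ c)                      ≡⟨ toℕ-↑ˡ _ c ⟩
  toℕ (i ↑ˡ b)                             ≡⟨ toℕ-↑ˡ i b ⟩
  toℕ i                                    ≡⟨ toℕ-↑ˡ i (b + c) ⟨
  toℕ (i ↑ˡ (b + c))                       ∎)
  where open ≡-Reasoning

assocI-↑ʳ-↑ˡ : ∀ a {b} c (j : Fin b) → fun (assocI a b c) ((a ↑ʳ j) ↑ˡ c) ≡ a ↑ʳ (j ↑ˡ c)
assocI-↑ʳ-↑ˡ a {b} c j = toℕ-injective (begin
  toℕ (fun (assocI a b c) ((a ↑ʳ j) ↑ˡ c)) ≡⟨ toℕ-cast _ _ ⟩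
  toℕ ((a ↑ʳ j) ↑ˡ c)                      ≡⟨ toℕ-↑ˡ _ c ⟩
  toℕ (a ↑ʳ j)                             ≡⟨ toℕ-↑ʳ a j ⟩
  a + toℕ j                                ≡⟨ cong (a +_) (toℕ-↑ˡ j c) ⟨
  a + toℕ (j ↑ˡ c)                         ≡⟨ toℕ-↑ʳ a (j ↑ˡ c) ⟨
  toℕ (a ↑ʳ (j ↑ˡ c))                      ∎)
  where open ≡-Reasoning

assocI-↑ʳ : ∀ a b {c} (k : Fin c) → fun (assocI a b c) ((a + b) ↑ʳ k) ≡ a ↑ʳ (b ↑ʳ k)
assocI-↑ʳ a b {c} k = toℕ-injective (begin
  toℕ (fun (assocI a b c) ((a + b) ↑ʳ k)) ≡⟨ toℕ-cast _ _ ⟩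
  toℕ ((a + b) ↑ʳ k)                      ≡⟨ toℕ-↑ʳ (a + b) k ⟩
  (a + b) + toℕ k                         ≡⟨ +-assoc a b (toℕ k) ⟩
  a + (b + toℕ k)                         ≡⟨ cong (a +_) (toℕ-↑ʳ b k) ⟨
  a + toℕ (b ↑ʳ k)                        ≡⟨ toℕ-↑ʳ a (b ↑ʳ k) ⟨
  toℕ (a ↑ʳ (b ↑ʳ k))                     ∎)
  where open ≡-Reasoning

amalgamate : ∀ {b d e} (k : Inj b d) (k' : Inj b e) →
             Σ ℕ λ Q → Σ (Inj d Q) λ p → Σ (Inj e Q) λ q → ∀ i → fun p (fun k i) ≡ fun q (fun k' i)
amalgamate {b} {d} {e} k k' = d + e , inlI e , mkInj q q-injective , commutes
  where
  preimage? : (j : Fin e) → Dec (∃ λ i → fun k' i ≡ j)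
  preimage? j = any? (λ i → fun k' i ≟ j)

  q : Fin e → Fin (d + e)
  q j with preimage? j
  ... | yes (i , _) = fun k i ↑ˡ e
  ... | no _        = d ↑ʳ j

  q-injective : ∀ {j j'} → q j ≡ q j' → j ≡ j'
  q-injective {j} {j'} eq with preimage? j | preimage? j'
  ... | yes (i , ei) | yes (i' , ei') =
        trans (sym ei) (trans (cong (fun k') (injective k (↑ˡ-injective e _ _ eq))) ei')
  ... | yes _ | no _  = ⊥-elim (↑ˡ≢↑ʳ _ _ eq)
  ... | no _  | yes _ = ⊥-elim (↑ˡ≢↑ʳ _ _ (sym eq))
  ... | no _  | no _  = ↑ʳ-injective d _ _ eq

  commutes : ∀ i → fun k i ↑ˡ e ≡ q (fun k' i)
  commutes i with preimage? (fun k' i)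
  ... | yes (i' , ei') = cong (λ z → fun k z ↑ˡ e) (sym (injective k' ei'))
  ... | no ¬pre        = ⊥-elim (¬pre (i , refl))

-- Objects of [Inj, Set]

module ObjProperties (X : Obj) where
  open Obj X
  open PreObj pre public using (act)

  module _ {k : ℕ} where
    open Setoid (PreObj.S pre k) public
      using () renaming (refl to ≈-refl; sym to ≈-sym; trans to ≈-trans)

  module ≈-Reasoning {k : ℕ} = SetoidReasoning (PreObj.S pre k)

  act-congʳ : ∀ {a b} (f : Inj a b) {x y} → Eq pre a x y → Eq pre b (act f x) (act f y)
  act-congʳ f = act-cong f f (λ _ → refl)

  act-ext : ∀ {a b} {f g : Inj a b} → f ≗I g → ∀ x → Eq pre b (act f x) (act g x)
  act-ext {f = f} {g} f≗g x = act-cong f g f≗g ≈-refl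

  act-∘-≗ : ∀ {a b c} (f : Inj b c) (g : Inj a b) (h : Inj a c) →
            (∀ i → fun f (fun g i) ≡ fun h i) → ∀ x → Eq pre c (act f (act g x)) (act h x)
  act-∘-≗ f g h fg≗h x = ≈-trans (≈-sym (act-∘ f g x)) (act-ext fg≗h x)

  act-⊕idI-∘ : ∀ {a a' a'' d} (f : Inj a' a'') (g : Inj a a') (h : Inj a a'') →
               (∀ i → fun f (fun g i) ≡ fun h i) → ∀ x →
               Eq pre (a'' + d) (act (f ⊕ idI {d}) (act (g ⊕ idI {d}) x)) (act (h ⊕ idI {d}) x)
  act-⊕idI-∘ {d = d} f g h fg≗h =
    act-∘-≗ (f ⊕ idI) (g ⊕ idI) (h ⊕ idI)
      (λ i → trans (⊕-∘ f (idI {d}) g idI i)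
                   (⊕-cong {f = f ∘I g} {f' = h} {g = idI {d}} {g' = idI} fg≗h (λ _ → refl) i))

  act-∘₃-≗ : ∀ {a b c d} (f : Inj c d) (g : Inj b c) (h : Inj a b) (e : Inj a d) →
             (∀ i → fun f (fun g (fun h i)) ≡ fun e i) → ∀ x →
             Eq pre d (act f (act g (act h x))) (act e x)
  act-∘₃-≗ f g h e fgh≗e x =
    ≈-trans (act-congʳ f (≈-sym (act-∘ g h x))) (act-∘-≗ f (g ∘I h) e fgh≗e x)

  act-⊕idI-∘₄ : ∀ {a₀ a₁ a₂ a₃ a₄ d} (f₁ : Inj a₃ a₄) (f₂ : Inj a₂ a₃) (f₃ : Inj a₁ a₂) (f₄ : Inj a₀ a₁)
                (g : Inj a₀ a₄) → (∀ q → fun f₁ (fun f₂ (fun f₃ (fun f₄ q))) ≡ fun g q) → ∀ x →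
                Eq pre (a₄ + d) (act (f₁ ⊕ idI {d}) (act (f₂ ⊕ idI) (act (f₃ ⊕ idI) (act (f₄ ⊕ idI) x))))
                                (act (g ⊕ idI) x)
  act-⊕idI-∘₄ f₁ f₂ f₃ f₄ g f₁₂₃₄≗g x = begin
    act (f₁ ⊕ idI) (act (f₂ ⊕ idI) (act (f₃ ⊕ idI) (act (f₄ ⊕ idI) x)))
      ≈⟨ act-congʳ (f₁ ⊕ idI) (act-congʳ (f₂ ⊕ idI) (act-⊕idI-∘ f₃ f₄ (f₃ ∘I f₄) (λ _ → refl) x)) ⟩
    act (f₁ ⊕ idI) (act (f₂ ⊕ idI) (act ((f₃ ∘I f₄) ⊕ idI) x))
      ≈⟨ act-congʳ (f₁ ⊕ idI) (act-⊕idI-∘ f₂ (f₃ ∘I f₄) (f₂ ∘I (f₃ ∘I f₄)) (λ _ → refl) x) ⟩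
    act (f₁ ⊕ idI) (act ((f₂ ∘I (f₃ ∘I f₄)) ⊕ idI) x)
      ≈⟨ act-⊕idI-∘ f₁ (f₂ ∘I (f₃ ∘I f₄)) g f₁₂₃₄≗g x ⟩
    act (g ⊕ idI) x ∎
    where open ≈-Reasoning

component : (A : PreObj) (n : ℕ) {k : ℕ} → ∣ pow A n ∣ k → Fin n → ∣ A ∣ k
component A (suc n) (x , _) Fin.zero    = x
component A (suc n) (_ , v) (Fin.suc i) = component A n v i

component-act : (A : PreObj) (n : ℕ) {k l : ℕ} (f : Inj k l) (v : ∣ pow A n ∣ k) (i : Fin n) →
                component A n (PreObj.act (pow A n) f v) i ≡ PreObj.act A f (component A n v i)
component-act A (suc n) f v Fin.zero    = refl
component-act A (suc n) f v (Fin.suc i) = component-act A n f (proj₂ v) i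

component-cong : (A : PreObj) (n : ℕ) {k : ℕ} {v v' : ∣ pow A n ∣ k} → Eq (pow A n) k v v' →
                 (i : Fin n) → Eq A k (component A n v i) (component A n v' i)
component-cong A (suc n) (x≈x' , _) Fin.zero    = x≈x'
component-cong A (suc n) (_ , v≈v') (Fin.suc i) = component-cong A n v≈v' i

powObj : Obj → ℕ → Obj
powObj X n = record { pre = pow A n ; act-cong = act-cong′ n ; act-id = act-id′ n ; act-∘ = act-∘′ n }
  where
  open Obj X renaming (pre to A)

  act-cong′ : ∀ n {a b} (f g : Inj a b) → f ≗I g → ∀ {x y} → Eq (pow A n) a x y →
              Eq (pow A n) b (PreObj.act (pow A n) f x) (PreObj.act (pow A n) g y)
  act-cong′ zero    f g f≗g _         = refl
  act-cong′ (suc n) f g f≗g (x≈y , v≈w) = act-cong f g f≗g x≈y , act-cong′ n f g f≗g v≈w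

  act-id′ : ∀ n {a} (v : ∣ pow A n ∣ a) → Eq (pow A n) a (PreObj.act (pow A n) idI v) v
  act-id′ zero    _       = refl
  act-id′ (suc n) (x , v) = act-id x , act-id′ n v

  act-∘′ : ∀ n {a b c} (g : Inj b c) (f : Inj a b) (v : ∣ pow A n ∣ a) →
           Eq (pow A n) c (PreObj.act (pow A n) (g ∘I f) v)
                          (PreObj.act (pow A n) g (PreObj.act (pow A n) f v))
  act-∘′ zero    g f _       = refl
  act-∘′ (suc n) g f (x , v) = act-∘ g f x , act-∘′ n g f v

module CospanCharacterisation (Z : Obj) where
  open Obj Z renaming (pre to A)
  open ObjProperties Z

  Cospan : ∀ {a} → TCar A a → TCar A a → Set
  Cospan {a} (b , x) (b' , x') = Σ ℕ λ D → Σ (Inj b D) λ k → Σ (Inj b' D) λ k' →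
    Eq A (a + D) (act (idI ⊕ k) x) (act (idI ⊕ k') x')

  TRel⇒Cospan : ∀ {a} {u v : TCar A a} → TRel A u v → Cospan u v
  TRel⇒Cospan {a} (t-lift {b} x≈y) = b , idI , idI , act-congʳ (idI {a} ⊕ idI {b}) x≈y
  TRel⇒Cospan {a} (t-step {b' = b'} f x) = b' , f , idI ,
    ≈-sym (≈-trans (act-ext (⊕-id {a} {b'}) _) (act-id _))
  TRel⇒Cospan t-refl = _ , idI , idI , ≈-refl
  TRel⇒Cospan (t-sym r) with TRel⇒Cospan r
  ... | D , k , k' , e = D , k' , k , ≈-sym e
  TRel⇒Cospan {a} (t-trans {_ , x₁} {_ , x₂} {_ , x₃} r s)
    with TRel⇒Cospan r | TRel⇒Cospan s
  ... | D , k₁ , k₂ , e₁ | D' , k₂' , k₃ , e₂ with amalgamate k₂ k₂'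
  ... | Q , p , q , commutes = Q , p ∘I k₁ , q ∘I k₃ , (begin
    act (idI ⊕ (p ∘I k₁)) x₁         ≈⟨ push p k₁ x₁ ⟨
    act (idI ⊕ p) (act (idI ⊕ k₁) x₁) ≈⟨ act-congʳ (idI ⊕ p) e₁ ⟩
    act (idI ⊕ p) (act (idI ⊕ k₂) x₂) ≈⟨ push p k₂ x₂ ⟩
    act (idI ⊕ (p ∘I k₂)) x₂         ≈⟨ act-ext (⊕-cong {f = idI {a}} {f' = idI} {g = p ∘I k₂} {g' = q ∘I k₂'}
                                                        (λ _ → refl) commutes) x₂ ⟩
    act (idI ⊕ (q ∘I k₂')) x₂        ≈⟨ push q k₂' x₂ ⟨
    act (idI ⊕ q) (act (idI ⊕ k₂') x₂) ≈⟨ act-congʳ (idI ⊕ q) e₂ ⟩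
    act (idI ⊕ q) (act (idI ⊕ k₃) x₃) ≈⟨ push q k₃ x₃ ⟩
    act (idI ⊕ (q ∘I k₃)) x₃         ∎)
    where
    open ≈-Reasoning
    push : ∀ {b D E} (p : Inj D E) (k : Inj b D) (x : ∣ A ∣ (a + b)) →
           Eq A (a + E) (act (idI ⊕ p) (act (idI ⊕ k) x)) (act (idI ⊕ (p ∘I k)) x)
    push p k = act-∘-≗ (idI ⊕ p) (idI ⊕ k) (idI ⊕ (p ∘I k)) (⊕-∘ idI p idI k)

-- The sampling maps

module Sampling (X : Obj) where
  open Obj X renaming (pre to A)
  open ObjProperties X

  record FreshCopies (n L b : ℕ) (z : Fin n → ∣ A ∣ (L + b)) (P : ℕ) (w : ∣ pow A n ∣ (L + P)) : Set where
    field
      block      : Fin n → Inj b P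
      disjoint   : ∀ {i i' m m'} → fun (block i) m ≡ fun (block i') m' → i ≡ i'
      component≈ : ∀ i → Eq A (L + P) (component A n w i) (act (idI ⊕ block i) (z i))

  forceN-fresh : ∀ n K b (z : Fin n → ∣ A ∣ (K + b)) (v : ∣ pow (T A) n ∣ K) →
                 (∀ i → component (T A) n v i ≡ (b , z i)) →
                 FreshCopies n K b z (proj₁ (forceN A n K v)) (proj₂ (forceN A n K v))
  forceN-fresh zero    K b z v _ = record { block = λ () ; disjoint = λ { {()} } ; component≈ = λ () }
  forceN-fresh (suc n) K b z (t , r) v≡z with v≡z Fin.zero
  ... | refl = record { block = block ; disjoint = disjoint ; component≈ = component≈ }
    where
    module IH = FreshCopies (forceN-fresh n K b (z ∘ Fin.suc) r (v≡z ∘ Fin.suc))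
    N = proj₁ (forceN A n K r)

    block : Fin (suc n) → Inj b (b + N)
    block Fin.zero    = inlI N
    block (Fin.suc i) = inrI b ∘I IH.block i

    disjoint : ∀ {i i' m m'} → fun (block i) m ≡ fun (block i') m' → i ≡ i'
    disjoint {Fin.zero}  {Fin.zero}   _ = refl
    disjoint {Fin.zero}  {Fin.suc _}  e = ⊥-elim (↑ˡ≢↑ʳ _ _ e)
    disjoint {Fin.suc _} {Fin.zero}   e = ⊥-elim (↑ˡ≢↑ʳ _ _ (sym e))
    disjoint {Fin.suc _} {Fin.suc _}  e = cong Fin.suc (IH.disjoint (↑ʳ-injective b _ _ e))

    component≈ : ∀ i → Eq A (K + (b + N)) (component A (suc n) (proj₂ (forceN A (suc n) K ((b , z Fin.zero) , r))) i)
                                          (act (idI ⊕ block i) (z i))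
    component≈ Fin.zero    = ≈-refl
    component≈ (Fin.suc i) = begin
      component A n (PreObj.act (pow A n) (idI {K} ⊕ inrI b {N}) (proj₂ (forceN A n K r))) i
        ≡⟨ component-act A n (idI {K} ⊕ inrI b {N}) _ i ⟩
      act (idI {K} ⊕ inrI b {N}) (component A n (proj₂ (forceN A n K r)) i)
        ≈⟨ act-congʳ (idI {K} ⊕ inrI b {N}) (IH.component≈ i) ⟩
      act (idI {K} ⊕ inrI b {N}) (act (idI ⊕ IH.block i) (z (Fin.suc i)))
        ≈⟨ act-∘-≗ (idI {K} ⊕ inrI b {N}) (idI ⊕ IH.block i) (idI ⊕ block (Fin.suc i))
                   (⊕-∘ (idI {K}) (inrI b {N}) (idI {K}) (IH.block i)) _ ⟩
      act (idI ⊕ block (Fin.suc i)) (z (Fin.suc i)) ∎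
      where open ≈-Reasoning

  copyN-component : ∀ n L b (x : ∣ A ∣ (L + b)) (i : Fin n) →
    let M = proj₁ (copyN (T A) n L (b , x)) in
    Σ (∣ A ∣ ((L + M) + b)) λ z →
      component (T A) n (proj₂ (copyN (T A) n L (b , x))) i ≡ (b , z) × Eq A ((L + M) + b) z (act (inlI M ⊕ idI {b}) x)
  copyN-component (suc n) L b x Fin.zero = _ , refl ,
    act-⊕idI-∘₄ {d = b} (assocI L 0 M) (idI {L + 0} ⊕ inlI M) (runitI (L + 0)) (runitI L) (inlI M)
      (λ q → trans (cong (fun (assocI L 0 M)) (⊕-↑ˡ (idI {L + 0}) (inlI M) (q ↑ˡ 0)))
                   (assocI-↑ˡ-↑ˡ 0 M q)) x
    where M = proj₁ (copyN (T A) n (L + 0) (b , act (runitI L ⊕ idI {b}) x))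
  copyN-component (suc n) L b x (Fin.suc i)
    with copyN-component n (L + 0) b (act (runitI L ⊕ idI {b}) x) i
  ... | z , v≡z , z≈x = _ , component≡ , z≈x′
    where
    M = proj₁ (copyN (T A) n (L + 0) (b , act (runitI L ⊕ idI {b}) x))
    v = proj₂ (copyN (T A) n (L + 0) (b , act (runitI L ⊕ idI {b}) x))
    ι = idI {L + 0} ⊕ inrI 0 {M}

    z≈x′ : Eq A _ (act (assocI L 0 M ⊕ idI {b}) (act (ι ⊕ idI {b}) z)) (act (inlI M ⊕ idI {b}) x)
    z≈x′ = begin
      act (assocI L 0 M ⊕ idI {b}) (act (ι ⊕ idI {b}) z)
        ≈⟨ act-congʳ (assocI L 0 M ⊕ idI {b}) (act-congʳ (ι ⊕ idI {b}) z≈x) ⟩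
      act (assocI L 0 M ⊕ idI {b}) (act (ι ⊕ idI {b}) (act (inlI M ⊕ idI {b}) (act (runitI L ⊕ idI {b}) x)))
        ≈⟨ act-⊕idI-∘₄ {d = b} (assocI L 0 M) ι (inlI M) (runitI L) (inlI M)
             (λ q → trans (cong (fun (assocI L 0 M)) (⊕-↑ˡ (idI {L + 0}) (inrI 0) (q ↑ˡ 0)))
                          (assocI-↑ˡ-↑ˡ 0 M q)) x ⟩
      act (inlI M ⊕ idI {b}) x ∎
      where open ≈-Reasoning

    component≡ : component (T A) n (PreObj.act (pow (T A) n) (assocI L 0 M)
                                     (PreObj.act (pow (T A) n) ι v)) i
                 ≡ (b , act (assocI L 0 M ⊕ idI) (act (ι ⊕ idI) z))
    component≡ = begin
      component (T A) n (PreObj.act (pow (T A) n) (assocI L 0 M) (PreObj.act (pow (T A) n) ι v)) i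
        ≡⟨ component-act (T A) n (assocI L 0 M) _ i ⟩
      Tact A (assocI L 0 M) (component (T A) n (PreObj.act (pow (T A) n) ι v) i)
        ≡⟨ cong (Tact A (assocI L 0 M)) (component-act (T A) n ι v i) ⟩
      Tact A (assocI L 0 M) (Tact A ι (component (T A) n v i))
        ≡⟨ cong (Tact A (assocI L 0 M) ∘ Tact A ι) v≡z ⟩
      (b , act (assocI L 0 M ⊕ idI) (act (ι ⊕ idI) z)) ∎
      where open ≡-Reasoning

  samp-fresh : ∀ n L b (x : ∣ A ∣ (L + b)) →
    FreshCopies n L b (λ _ → x) (proj₁ (samp A n L (b , x))) (proj₂ (samp A n L (b , x)))
  samp-fresh n L b x = record
    { block = λ i → inrI M ∘I F.block i
    ; disjoint = F.disjoint ∘ ↑ʳ-injective M _ _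
    ; component≈ = component≈ }
    where
    M = proj₁ (copyN (T A) n L (b , x))
    v = proj₂ (copyN (T A) n L (b , x))
    copies = copyN-component n L b x
    module F = FreshCopies (forceN-fresh n (L + M) b (proj₁ ∘ copies) v (proj₁ ∘ proj₂ ∘ copies))
    N = proj₁ (forceN A n (L + M) v)
    w = proj₂ (forceN A n (L + M) v)

    reindex≗ : ∀ i → ∀ p → fun (assocI L M N) (fun (idI {L + M} ⊕ F.block i) (fun (inlI M ⊕ idI {b}) p))
                          ≡ fun (idI {L} ⊕ (inrI M ∘I F.block i)) p
    reindex≗ i = ↑-ext
      (λ q → begin
        fun (assocI L M N) (fun (idI {L + M} ⊕ F.block i) (fun (inlI M ⊕ idI {b}) (q ↑ˡ b)))
          ≡⟨ cong (fun (assocI L M N) ∘ fun (idI {L + M} ⊕ F.block i)) (⊕-↑ˡ (inlI M) (idI {b}) q) ⟩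
        fun (assocI L M N) (fun (idI {L + M} ⊕ F.block i) ((q ↑ˡ M) ↑ˡ b))
          ≡⟨ cong (fun (assocI L M N)) (⊕-↑ˡ (idI {L + M}) (F.block i) (q ↑ˡ M)) ⟩
        fun (assocI L M N) ((q ↑ˡ M) ↑ˡ N)
          ≡⟨ assocI-↑ˡ-↑ˡ M N q ⟩
        q ↑ˡ (M + N)
          ≡⟨ ⊕-↑ˡ (idI {L}) (inrI M ∘I F.block i) q ⟨
        fun (idI {L} ⊕ (inrI M ∘I F.block i)) (q ↑ˡ b) ∎)
      (λ m → begin
        fun (assocI L M N) (fun (idI {L + M} ⊕ F.block i) (fun (inlI M ⊕ idI {b}) (L ↑ʳ m)))
          ≡⟨ cong (fun (assocI L M N) ∘ fun (idI {L + M} ⊕ F.block i)) (⊕-↑ʳ (inlI M) (idI {b}) m) ⟩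
        fun (assocI L M N) (fun (idI {L + M} ⊕ F.block i) ((L + M) ↑ʳ m))
          ≡⟨ cong (fun (assocI L M N)) (⊕-↑ʳ (idI {L + M}) (F.block i) m) ⟩
        fun (assocI L M N) ((L + M) ↑ʳ fun (F.block i) m)
          ≡⟨ assocI-↑ʳ L M (fun (F.block i) m) ⟩
        L ↑ʳ (M ↑ʳ fun (F.block i) m)
          ≡⟨ ⊕-↑ʳ (idI {L}) (inrI M ∘I F.block i) m ⟨
        fun (idI {L} ⊕ (inrI M ∘I F.block i)) (L ↑ʳ m) ∎)
      where open ≡-Reasoning

    component≈ : ∀ i → Eq A (L + (M + N)) (component A n (PreObj.act (pow A n) (assocI L M N) w) i)
                                          (act (idI {L} ⊕ (inrI M ∘I F.block i)) x)
    component≈ i = begin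
      component A n (PreObj.act (pow A n) (assocI L M N) w) i
        ≡⟨ component-act A n (assocI L M N) w i ⟩
      act (assocI L M N) (component A n w i)
        ≈⟨ act-congʳ (assocI L M N) (F.component≈ i) ⟩
      act (assocI L M N) (act (idI {L + M} ⊕ F.block i) (proj₁ (copies i)))
        ≈⟨ act-congʳ (assocI L M N) (act-congʳ (idI {L + M} ⊕ F.block i) (proj₂ (proj₂ (copies i)))) ⟩
      act (assocI L M N) (act (idI {L + M} ⊕ F.block i) (act (inlI M ⊕ idI {b}) x))
        ≈⟨ act-∘₃-≗ (assocI L M N) (idI {L + M} ⊕ F.block i) (inlI M ⊕ idI {b}) _ (reindex≗ i) x ⟩
      act (idI {L} ⊕ (inrI M ∘I F.block i)) x ∎
      where open ≈-Reasoning

-- Recovering an element of T (T X) from its samples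

module Observation (X : Obj) where
  open Obj X renaming (pre to A)
  open ObjProperties X
  open Sampling X

  sample : ∀ n {a} → TCar (T A) a → TCar (pow A n) a
  sample n {a} t = μ (pow A n) a (Tmap {T A} {T (pow A n)} (samp A n) a t)

  reindex-both : ∀ {a c b D D'} (h : Inj c D) (g : Inj b D') (x : ∣ A ∣ ((a + c) + b)) →
                 TRel (T A) (c , (b , x)) (D , (D' , act ((idI ⊕ h) ⊕ g) x))
  reindex-both {a} {b = b} {D} h g x =
    t-trans (t-step h (b , x)) (t-lift (t-trans (t-step g _) (t-lift
      (act-∘-≗ (idI ⊕ g) ((idI {a} ⊕ h) ⊕ idI {b}) ((idI ⊕ h) ⊕ g) (⊕-∘ (idI {a + D}) g (idI ⊕ h) idI) x))))

  module Separation (a : ℕ) {D : ℕ} (S : Fin D → Set) (S? : Decidable S) where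
    -- Names of D in S stay bound by the outer binder of T (T A), the others move to the inner one.
    σ : Fin D → Fin ((a + D) + D)
    σ d with S? d
    ... | yes _ = (a ↑ʳ d) ↑ˡ D
    ... | no _  = (a + D) ↑ʳ d

    σ-∈ : ∀ {d} → S d → σ d ≡ (a ↑ʳ d) ↑ˡ D
    σ-∈ {d} d∈S with S? d
    ... | yes _  = refl
    ... | no d∉S = ⊥-elim (d∉S d∈S)

    σ-∉ : ∀ {d} → ¬ S d → σ d ≡ (a + D) ↑ʳ d
    σ-∉ {d} d∉S with S? d
    ... | yes d∈S = ⊥-elim (d∉S d∈S)
    ... | no _    = refl

    σ-injective : ∀ {d d'} → σ d ≡ σ d' → d ≡ d'
    σ-injective {d} {d'} e with S? d | S? d'
    ... | yes _ | yes _ = ↑ʳ-injective a _ _ (↑ˡ-injective D _ _ e)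
    ... | yes _ | no _  = ⊥-elim (↑ˡ≢↑ʳ _ _ e)
    ... | no _  | yes _ = ⊥-elim (↑ˡ≢↑ʳ _ _ (sym e))
    ... | no _  | no _  = ↑ʳ-injective (a + D) _ _ e

    ↑ˡ-↑ˡ≢σ : ∀ o d → (o ↑ˡ D) ↑ˡ D ≢ σ d
    ↑ˡ-↑ˡ≢σ o d e with S? d
    ... | yes _ = ↑ˡ≢↑ʳ _ _ (↑ˡ-injective D _ _ e)
    ... | no _  = ↑ˡ≢↑ʳ _ _ e

    sep : Fin (a + D) → Fin ((a + D) + D)
    sep p = [ (λ o → (o ↑ˡ D) ↑ˡ D) , σ ]′ (splitAt a p)

    sep-↑ˡ : ∀ o → sep (o ↑ˡ D) ≡ (o ↑ˡ D) ↑ˡ D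
    sep-↑ˡ o rewrite splitAt-↑ˡ a o D = refl

    sep-↑ʳ : ∀ d → sep (a ↑ʳ d) ≡ σ d
    sep-↑ʳ d rewrite splitAt-↑ʳ a D d = refl

    sep-injective : ∀ {p p'} → sep p ≡ sep p' → p ≡ p'
    sep-injective {p} {p'} e with splitView a D p | splitView a D p'
    ... | ↑ˡ-view o | ↑ˡ-view o' = cong (_↑ˡ D) (↑ˡ-injective D _ _ (↑ˡ-injective D _ _
                                     (trans (sym (sep-↑ˡ o)) (trans e (sep-↑ˡ o')))))
    ... | ↑ˡ-view o | ↑ʳ-view d' = ⊥-elim (↑ˡ-↑ˡ≢σ o d' (trans (sym (sep-↑ˡ o)) (trans e (sep-↑ʳ d'))))
    ... | ↑ʳ-view d | ↑ˡ-view o' = ⊥-elim (↑ˡ-↑ˡ≢σ o' d (trans (sym (sep-↑ˡ o')) (trans (sym e) (sep-↑ʳ d))))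
    ... | ↑ʳ-view d | ↑ʳ-view d' = cong (a ↑ʳ_) (σ-injective (trans (sym (sep-↑ʳ d)) (trans e (sep-↑ʳ d'))))

    separate : Inj (a + D) ((a + D) + D)
    separate = mkInj sep sep-injective

    module _ {n c b : ℕ} (x : ∣ A ∣ ((a + c) + b)) where
      open FreshCopies (samp-fresh n (a + c) b x)
      private
        P = proj₁ (samp A n (a + c) (b , x))
        w = proj₂ (samp A n (a + c) (b , x))

      separate-reindex≗ : (k : Inj (c + P) D) (i : Fin n) →
        (∀ (j : Fin c) → S (fun k (j ↑ˡ P))) → (∀ m → ¬ S (fun k (c ↑ʳ fun (block i) m))) → ∀ p →
        sep (fun (idI {a} ⊕ k) (fun (assocI a c P) (fun (idI {a + c} ⊕ block i) p)))
          ≡ fun ((idI {a} ⊕ (k ∘I inlI P)) ⊕ (k ∘I (inrI c ∘I block i))) p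
      separate-reindex≗ k i outer∈S inner∉S = ↑-ext (↑-ext on-free on-outer) on-inner
        where
        open ≡-Reasoning
        h = k ∘I inlI P
        g = k ∘I (inrI c ∘I block i)
        on-free : ∀ o → sep (fun (idI {a} ⊕ k) (fun (assocI a c P) (fun (idI {a + c} ⊕ block i) ((o ↑ˡ c) ↑ˡ b))))
                            ≡ fun ((idI {a} ⊕ h) ⊕ g) ((o ↑ˡ c) ↑ˡ b)
        on-free o = begin
          sep (fun (idI {a} ⊕ k) (fun (assocI a c P) (fun (idI {a + c} ⊕ block i) ((o ↑ˡ c) ↑ˡ b))))
            ≡⟨ cong (sep ∘ fun (idI {a} ⊕ k) ∘ fun (assocI a c P)) (⊕-↑ˡ (idI {a + c}) (block i) (o ↑ˡ c)) ⟩
          sep (fun (idI {a} ⊕ k) (fun (assocI a c P) ((o ↑ˡ c) ↑ˡ P)))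
            ≡⟨ cong (sep ∘ fun (idI {a} ⊕ k)) (assocI-↑ˡ-↑ˡ c P o) ⟩
          sep (fun (idI {a} ⊕ k) (o ↑ˡ (c + P)))
            ≡⟨ cong sep (⊕-↑ˡ (idI {a}) k o) ⟩
          sep (o ↑ˡ D)
            ≡⟨ sep-↑ˡ o ⟩
          (o ↑ˡ D) ↑ˡ D
            ≡⟨ cong (_↑ˡ D) (⊕-↑ˡ (idI {a}) h o) ⟨
          fun (idI {a} ⊕ h) (o ↑ˡ c) ↑ˡ D
            ≡⟨ ⊕-↑ˡ (idI {a} ⊕ h) g (o ↑ˡ c) ⟨
          fun ((idI {a} ⊕ h) ⊕ g) ((o ↑ˡ c) ↑ˡ b) ∎
        on-outer : ∀ j → sep (fun (idI {a} ⊕ k) (fun (assocI a c P) (fun (idI {a + c} ⊕ block i) ((a ↑ʳ j) ↑ˡ b))))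
                            ≡ fun ((idI {a} ⊕ h) ⊕ g) ((a ↑ʳ j) ↑ˡ b)
        on-outer j = begin
          sep (fun (idI {a} ⊕ k) (fun (assocI a c P) (fun (idI {a + c} ⊕ block i) ((a ↑ʳ j) ↑ˡ b))))
            ≡⟨ cong (sep ∘ fun (idI {a} ⊕ k) ∘ fun (assocI a c P)) (⊕-↑ˡ (idI {a + c}) (block i) (a ↑ʳ j)) ⟩
          sep (fun (idI {a} ⊕ k) (fun (assocI a c P) ((a ↑ʳ j) ↑ˡ P)))
            ≡⟨ cong (sep ∘ fun (idI {a} ⊕ k)) (assocI-↑ʳ-↑ˡ a P j) ⟩
          sep (fun (idI {a} ⊕ k) (a ↑ʳ (j ↑ˡ P)))
            ≡⟨ cong sep (⊕-↑ʳ (idI {a}) k (j ↑ˡ P)) ⟩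
          sep (a ↑ʳ fun h j)
            ≡⟨ sep-↑ʳ (fun h j) ⟩
          σ (fun h j)
            ≡⟨ σ-∈ (outer∈S j) ⟩
          (a ↑ʳ fun h j) ↑ˡ D
            ≡⟨ cong (_↑ˡ D) (⊕-↑ʳ (idI {a}) h j) ⟨
          fun (idI {a} ⊕ h) (a ↑ʳ j) ↑ˡ D
            ≡⟨ ⊕-↑ˡ (idI {a} ⊕ h) g (a ↑ʳ j) ⟨
          fun ((idI {a} ⊕ h) ⊕ g) ((a ↑ʳ j) ↑ˡ b) ∎
        on-inner : ∀ m → sep (fun (idI {a} ⊕ k) (fun (assocI a c P) (fun (idI {a + c} ⊕ block i) ((a + c) ↑ʳ m))))
                            ≡ fun ((idI {a} ⊕ h) ⊕ g) ((a + c) ↑ʳ m)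
        on-inner m = begin
          sep (fun (idI {a} ⊕ k) (fun (assocI a c P) (fun (idI {a + c} ⊕ block i) ((a + c) ↑ʳ m))))
            ≡⟨ cong (sep ∘ fun (idI {a} ⊕ k) ∘ fun (assocI a c P)) (⊕-↑ʳ (idI {a + c}) (block i) m) ⟩
          sep (fun (idI {a} ⊕ k) (fun (assocI a c P) ((a + c) ↑ʳ fun (block i) m)))
            ≡⟨ cong (sep ∘ fun (idI {a} ⊕ k)) (assocI-↑ʳ a c (fun (block i) m)) ⟩
          sep (fun (idI {a} ⊕ k) (a ↑ʳ (c ↑ʳ fun (block i) m)))
            ≡⟨ cong sep (⊕-↑ʳ (idI {a}) k (c ↑ʳ fun (block i) m)) ⟩
          sep (a ↑ʳ fun g m)
            ≡⟨ sep-↑ʳ (fun g m) ⟩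
          σ (fun g m)
            ≡⟨ σ-∉ (inner∉S m) ⟩
          (a + D) ↑ʳ fun g m
            ≡⟨ ⊕-↑ʳ (idI {a} ⊕ h) g m ⟨
          fun ((idI {a} ⊕ h) ⊕ g) ((a + c) ↑ʳ m) ∎

      separated-copy : (k : Inj (c + P) D) (i : Fin n) →
        (∀ (j : Fin c) → S (fun k (j ↑ˡ P))) → (∀ m → ¬ S (fun k (c ↑ʳ fun (block i) m))) →
        TRel (T A) (c , (b , x))
                   (D , (D , act separate (act (idI {a} ⊕ k) (component A n (proj₂ (sample n (c , (b , x)))) i))))
      separated-copy k i outer∈S inner∉S =
        t-trans (reindex-both h g x) (t-lift (t-lift (≈-sym copy≈)))
        where
        h = k ∘I inlI P
        g = k ∘I (inrI c ∘I block i)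
        as = assocI a c P
        copy≈ : Eq A ((a + D) + D)
                  (act separate (act (idI ⊕ k) (component A n (PreObj.act (pow A n) as w) i)))
                  (act ((idI ⊕ h) ⊕ g) x)
        copy≈ = begin
          act separate (act (idI ⊕ k) (component A n (PreObj.act (pow A n) as w) i))
            ≡⟨ cong (act separate ∘ act (idI ⊕ k)) (component-act A n as w i) ⟩
          act separate (act (idI ⊕ k) (act as (component A n w i)))
            ≈⟨ act-congʳ separate (act-congʳ (idI ⊕ k) (act-congʳ as (component≈ i))) ⟩
          act separate (act (idI ⊕ k) (act as (act (idI ⊕ block i) x)))
            ≈⟨ act-congʳ separate (act-congʳ (idI ⊕ k) (≈-sym (act-∘ as (idI ⊕ block i) x))) ⟩
          act separate (act (idI ⊕ k) (act (as ∘I (idI ⊕ block i)) x))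
            ≈⟨ act-∘₃-≗ separate (idI ⊕ k) (as ∘I (idI ⊕ block i)) ((idI ⊕ h) ⊕ g)
                         (separate-reindex≗ k i outer∈S inner∉S) x ⟩
          act ((idI ⊕ h) ⊕ g) x ∎
          where open ≈-Reasoning

  module Matching {a n c b c' b' : ℕ} (x : ∣ A ∣ ((a + c) + b)) (x' : ∣ A ∣ ((a + c') + b')) {D : ℕ}
                  (k : Inj (proj₁ (sample n (c , (b , x)))) D) (k' : Inj (proj₁ (sample n (c' , (b' , x')))) D)
                  where
    private
      P  = proj₁ (samp A n (a + c) (b , x))
      P' = proj₁ (samp A n (a + c') (b' , x'))
    module L = FreshCopies (samp-fresh n (a + c) b x)
    module R = FreshCopies (samp-fresh n (a + c') b' x')

    Collision : Fin n → Set
    Collision i = (Σ (Fin b) λ m → Σ (Fin c') λ j' → fun k (c ↑ʳ fun (L.block i) m) ≡ fun k' (j' ↑ˡ P'))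
                ⊎ (Σ (Fin b') λ m' → Σ (Fin c) λ j → fun k' (c' ↑ʳ fun (R.block i) m') ≡ fun k (j ↑ˡ P))

    collision? : Decidable Collision
    collision? i = any? (λ m → any? (λ j' → fun k (c ↑ʳ fun (L.block i) m) ≟ fun k' (j' ↑ˡ P')))
              ⊎-dec any? (λ m' → any? (λ j → fun k' (c' ↑ʳ fun (R.block i) m') ≟ fun k (j ↑ˡ P)))

    collision-label : ∀ i → Collision i → Fin (c' + c)
    collision-label i (inj₁ (_ , j' , _)) = j' ↑ˡ c
    collision-label i (inj₂ (_ , j , _))  = c' ↑ʳ j

    collision-label-injective : ∀ {i i'} (γ : Collision i) (γ' : Collision i') →
                                collision-label i γ ≡ collision-label i' γ' → i ≡ i'
    collision-label-injective (inj₁ (m , j , e)) (inj₁ (m' , j' , e')) same with ↑ˡ-injective c j j' same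
    ... | refl = L.disjoint (↑ʳ-injective c _ _ (injective k (trans e (sym e'))))
    collision-label-injective (inj₁ _) (inj₂ _) same = ⊥-elim (↑ˡ≢↑ʳ _ _ same)
    collision-label-injective (inj₂ _) (inj₁ _) same = ⊥-elim (↑ˡ≢↑ʳ _ _ (sym same))
    collision-label-injective (inj₂ (m , j , e)) (inj₂ (m' , j' , e')) same with ↑ʳ-injective c' j j' same
    ... | refl = R.disjoint (↑ʳ-injective c' _ _ (injective k' (trans e (sym e'))))

    collision-free : c' + c < n → ∃ λ i → ¬ Collision i
    collision-free bound = pigeonhole-∃¬ bound Collision collision? collision-label collision-label-injective

    Outer : Fin D → Set
    Outer d = (Σ (Fin c) λ j → fun k (j ↑ˡ P) ≡ d) ⊎ (Σ (Fin c') λ j' → fun k' (j' ↑ˡ P') ≡ d)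

    outer? : Decidable Outer
    outer? d = any? (λ j → fun k (j ↑ˡ P) ≟ d) ⊎-dec any? (λ j' → fun k' (j' ↑ˡ P') ≟ d)

    left-fresh-not-outer : ∀ {i} → ¬ Collision i → ∀ m → ¬ Outer (fun k (c ↑ʳ fun (L.block i) m))
    left-fresh-not-outer _     m (inj₁ (j , e))  = ↑ˡ≢↑ʳ _ _ (injective k e)
    left-fresh-not-outer clean m (inj₂ (j' , e)) = clean (inj₁ (m , j' , sym e))

    right-fresh-not-outer : ∀ {i} → ¬ Collision i → ∀ m' → ¬ Outer (fun k' (c' ↑ʳ fun (R.block i) m'))
    right-fresh-not-outer clean m' (inj₁ (j , e))  = clean (inj₂ (m' , j , sym e))
    right-fresh-not-outer _     m' (inj₂ (j' , e)) = ↑ˡ≢↑ʳ _ _ (injective k' e)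

  samples-determine-at : ∀ {a} n {c b c' b'} (x : ∣ A ∣ ((a + c) + b)) (x' : ∣ A ∣ ((a + c') + b')) →
    c' + c < n → TRel (pow A n) (sample n (c , (b , x))) (sample n (c' , (b' , x'))) →
    TRel (T A) (c , (b , x)) (c' , (b' , x'))
  samples-determine-at {a} n {c} {b} {c'} {b'} x x' bound same
    with CospanCharacterisation.TRel⇒Cospan (powObj X n) same
  ... | D , k , k' , k≈k' =
    t-trans (separated-copy x k i (λ j → inj₁ (j , refl)) (left-fresh-not-outer clean))
   (t-trans (t-lift (t-lift (act-congʳ separate copies≈)))
   (t-sym   (separated-copy x' k' i (λ j' → inj₂ (j' , refl)) (right-fresh-not-outer clean))))
    where
    open Matching {a} {n} {c} {b} {c'} {b'} x x' k k'
    open Separation a Outer outer?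
    W  = proj₂ (sample n (c , (b , x)))
    W' = proj₂ (sample n (c' , (b' , x')))
    i = proj₁ (collision-free bound)
    clean = proj₂ (collision-free bound)
    copies≈ : Eq A (a + D) (act (idI ⊕ k) (component A n W i)) (act (idI ⊕ k') (component A n W' i))
    copies≈ = begin
      act (idI ⊕ k) (component A n W i)                        ≡⟨ component-act A n (idI ⊕ k) W i ⟨
      component A n (PreObj.act (pow A n) (idI ⊕ k) W) i       ≈⟨ component-cong A n k≈k' i ⟩
      component A n (PreObj.act (pow A n) (idI ⊕ k') W') i     ≡⟨ component-act A n (idI ⊕ k') W' i ⟩
      act (idI ⊕ k') (component A n W' i)                      ∎
      where open ≈-Reasoning

  samples-determine : ∀ {a} (t t' : TCar (T A) a) →
    (∀ n → TRel (pow A n) (sample n t) (sample n t')) → TRel (T A) t t'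
  samples-determine (c , (b , x)) (c' , (b' , x')) same =
    samples-determine-at (suc (c' + c)) x x' (n<1+n (c' + c)) (same (suc (c' + c)))

theorem9p6 : Observational
theorem9p6 X Y f g same a y =
  Observation.samples-determine X (sharp f a y) (sharp g a y) (λ n → same n a y)
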